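{- Let $m>0$, $\rho,\rho'$ code retrieving functions for terms over state types $\alpha,\beta$, $r\subseteq\alpha\times\beta$, and terms $p_1,\dots,p_m$ over $\alpha$, $q_1,\dots,q_m$ over $\beta$ with $\rho,\rho'\models p_i\sqsupseteq_r q_i$ for all $i\in\{1,\dots,m\}$. Then $\rho,\rho'\models\Vert(p_1,\dots,p_m)\sqsupseteq_r\Vert(q_1,\dots,q_m)$.
   Context: Program terms over a state type $\alpha$ are generated by $p::=\mathbf{skip}\mid\mathbf{basic}\,f\mid\mathbf{cjump}\,C\,i\,p\mid\mathbf{while}\,C\,p\,p\mid\mathbf{if}\,C\,p\,p\mid p;p\mid\Vert(p_1,\dots,p_m)\mid\mathbf{await}\,C\,p$ ($f:\alpha\to\alpha$, $C\subseteq\alpha$, $i\in\mathbb N$, $m\ge1$). A code retrieving function $\rho$ maps $\mathbb N$ to terms. The program step relation $\rho\vdash(p,\sigma)\to_{\mathcal P}(p',\sigma')$ is the least relation with: $(\mathbf{basic}\,f,\sigma)\to(\mathbf{skip},f\sigma)$; $(\mathbf{cjump}\,C\,i\,p,\sigma)\to(\rho\,i,\sigma)$ if $\sigma\in C$, $\to(p,\sigma)$ otherwise; $(\mathbf{await}\,C\,p,\sigma)\to(\mathbf{skip},\sigma')$ if $\sigma\in C$ and $(p,\sigma)\to^*(\mathbf{skip},\sigma')$; $(\mathbf{if}\,C\,p_1\,p_2,\sigma)\to(p_1,\sigma)$ if $\sigma\in C$, $\to(p_2,\sigma)$ otherwise; for $x=\mathbf{while}\,C\,p_1\,p_2$: $(x,\sigma)\to(p_1;(\mathbf{skip};x),\sigma)$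 if $\sigma\in C$, $\to(p_2,\sigma)$ otherwise; $(p_1;p_2,\sigma)\to(p_1';p_2,\sigma')$ if $(p_1,\sigma)\to(p_1',\sigma')$; $(\mathbf{skip};p,\sigma)\to(p,\sigma)$; $(\Vert(\dots,p_i,\dots),\sigma)\to(\Vert(\dots,p_i',\dots),\sigma')$ if $(p_i,\sigma)\to(p_i',\sigma')$; $(\Vert(\mathbf{skip},\dots,\mathbf{skip}),\sigma)\to(\mathbf{skip},\sigma)$. A relation $X$ between terms over $\alpha$ and over $\beta$ is a simulation w.r.t. $\rho,\rho',r$ if (i) whenever $(p,q)\in X$, $(\sigma_1,\sigma_2)\in r$ and $\rho'\vdash(q,\sigma_2)\to_{\mathcal P}(q',\sigma_2')$, there is a step $\rho\vdash(p,\sigma_1)\to_{\mathcal P}(p',\sigma_1')$ with $(p',q')\in X$, $(\sigma_1',\sigma_2')\in r$; (ii) $(\mathbf{skip},q)\in X\Rightarrow q=\mathbf{skip}$; (iii) $(p,\mathbf{skip})\in X\Rightarrow p=\mathbf{skip}$. $\rho,\rho'\models p\sqsupseteq_r q$ means some simulation w.r.t. $\rho,\rho',r$ contains $(p,q)$. -}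

module Defs where

open import Data.Nat using (ℕ; suc)
open import Data.Fin using (Fin)
open import Data.Empty using (⊥)
open import Data.Vec using (Vec; _[_]≔_; lookup; replicate)
open import Data.Product using (_×_; _,_; Σ; ∃)
open import Relation.Binary.PropositionalEquality using (_≡_)
open import Relation.Binary.Construct.Closure.ReflexiveTransitive using (Star)

-- Program terms over a state type α.  Sets C ⊆ α are predicates α → Set.
-- Parallel composition takes a non-empty vector (m = suc n ≥ 1) of terms.
data Com (α : Set) : Set₁ where
  skip  : Com α
  basic : (α → α) → Com α
  cjump : (α → Set) → ℕ → Com α → Com α
  while : (α → Set) → Com α → Com α → Com α
  if    : (α → Set) → Com α → Com α → Com α
  _⨾_   : Com α → Com α → Com α
  par   : ∀ {n} → Vec (Com α) (suc n) → Com α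
  await : (α → Set) → Com α → Com α

infixr 5 _⨾_

data Step {α : Set} (ρ : ℕ → Com α) : Com α × α → Com α × α → Set₁ where
  basic-step : ∀ {f σ} → Step ρ (basic f , σ) (skip , f σ)
  cjump-t    : ∀ {C i p σ} → C σ → Step ρ (cjump C i p , σ) (ρ i , σ)
  cjump-f    : ∀ {C i p σ} → (C σ → ⊥) → Step ρ (cjump C i p , σ) (p , σ)
  await-step : ∀ {C p σ σ'} → C σ → Star (Step ρ) (p , σ) (skip , σ')
             → Step ρ (await C p , σ) (skip , σ')
  if-t       : ∀ {C p₁ p₂ σ} → C σ → Step ρ (if C p₁ p₂ , σ) (p₁ , σ)
  if-f       : ∀ {C p₁ p₂ σ} → (C σ → ⊥) → Step ρ (if C p₁ p₂ , σ) (p₂ , σ)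
  while-t    : ∀ {C p₁ p₂ σ} → C σ
             → Step ρ (while C p₁ p₂ , σ) (p₁ ⨾ (skip ⨾ while C p₁ p₂) , σ)
  while-f    : ∀ {C p₁ p₂ σ} → (C σ → ⊥)
             → Step ρ (while C p₁ p₂ , σ) (p₂ , σ)
  seq-step   : ∀ {p₁ p₁' p₂ σ σ'} → Step ρ (p₁ , σ) (p₁' , σ')
             → Step ρ (p₁ ⨾ p₂ , σ) (p₁' ⨾ p₂ , σ')
  seq-skip   : ∀ {p σ} → Step ρ (skip ⨾ p , σ) (p , σ)
  par-step   : ∀ {n} {ps : Vec (Com α) (suc n)} (i : Fin (suc n)) {p' σ σ'}
             → Step ρ (lookup ps i , σ) (p' , σ')
             → Step ρ (par ps , σ) (par (ps [ i ]≔ p') , σ')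
  par-skip   : ∀ {n σ} → Step ρ (par (replicate (suc n) skip) , σ) (skip , σ)

record IsSimulation {α β : Set} (ρ : ℕ → Com α) (ρ' : ℕ → Com β)
                    (r : α → β → Set) (X : Com α → Com β → Set₁) : Set₁ where
  field
    sim : ∀ {p q σ₁ σ₂ q' σ₂'} → X p q → r σ₁ σ₂
        → Step ρ' (q , σ₂) (q' , σ₂')
        → Σ (Com α × α) λ { (p' , σ₁') →
            Step ρ (p , σ₁) (p' , σ₁') × X p' q' × r σ₁' σ₂' }
    skipˡ : ∀ {q} → X skip q → q ≡ skip
    skipʳ : ∀ {p} → X p skip → p ≡ skip

Refines : {α β : Set} (ρ : ℕ → Com α) (ρ' : ℕ → Com β) (r : α → β → Set)
        → Com α → Com β → Set₂
Refines {α} {β} ρ ρ' r p q =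
  Σ (Com α → Com β → Set₁) λ X → IsSimulation ρ ρ' r X × X p q

module Submission where

-- Given simulations X₁, …, Xₘ witnessing pᵢ ⊒_r qᵢ, the witnessing
-- simulation for ‖(p₁,…,pₘ) ⊒_r ‖(q₁,…,qₘ) is the relation ParSim that
-- relates skip to skip, and ‖(ps) to ‖(qs) whenever every component pair
-- (psᵢ, qsᵢ) lies in Xᵢ.  A concrete step of ‖(qs) is either
--   * a step of one component qsᵢ: it is matched by the step of psᵢ that
--     Xᵢ provides, and updating position i on both sides keeps all
--     components related (lemma update-componentwise); or
--   * the termination step ‖(skip,…,skip) → skip: every psᵢ is related to
--     skip by Xᵢ, hence is skip itself, so ‖(ps) terminates as well
--     (lemma all-equal⇒replicate).

open import Defs
open import Level using (Level)
open import Data.Nat using (ℕ; suc)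
open import Data.Fin using (Fin; zero; suc; _≟_)
open import Data.Vec using (Vec; lookup; _∷_; []; replicate; _[_]≔_)
open import Data.Vec.Properties using (lookup∘update; lookup∘update′; lookup-replicate)
open import Data.Product using (Σ; _×_; _,_)
open import Relation.Binary.PropositionalEquality using (_≡_; refl; cong₂; subst)
open import Relation.Nullary using (yes; no)

private
  variable
    a b ℓ : Level
    A : Set a
    B : Set b

all-equal⇒replicate : ∀ {n} {x : A} (xs : Vec A n)
                    → (∀ i → lookup xs i ≡ x) → xs ≡ replicate n x
all-equal⇒replicate []       _  = refl
all-equal⇒replicate (y ∷ xs) eq = cong₂ _∷_ (eq zero) (all-equal⇒replicate xs (λ i → eq (suc i)))

Componentwise : ∀ {n} → (Fin n → A → B → Set ℓ) → Vec A n → Vec B n → Set ℓ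
Componentwise R xs ys = ∀ i → R i (lookup xs i) (lookup ys i)

update-componentwise : ∀ {n} {R : Fin n → A → B → Set ℓ} {xs ys} i {x y}
                     → Componentwise R xs ys → R i x y
                     → Componentwise R (xs [ i ]≔ x) (ys [ i ]≔ y)
update-componentwise {xs = xs} {ys} i {x} {y} related rᵢ j with j ≟ i
... | yes refl rewrite lookup∘update i xs x  | lookup∘update i ys y  = rᵢ
... | no j≢i   rewrite lookup∘update′ j≢i xs x | lookup∘update′ j≢i ys y = related j

module _ {α β : Set} (ρ : ℕ → Com α) (ρ' : ℕ → Com β) (r : α → β → Set)
         {n : ℕ} (Xs : Fin (suc n) → Com α → Com β → Set₁)
         (sims : ∀ i → IsSimulation ρ ρ' r (Xs i)) where

  data ParSim : Com α → Com β → Set₁ where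
    skip-skip : ParSim skip skip
    par-par   : ∀ {ps qs} → Componentwise Xs ps qs → ParSim (par ps) (par qs)

  -- If every component of ‖(ps) is related to skip, every component is skip,
  -- because each Xᵢ only relates skip to skip.
  components-skip : ∀ {ps} → Componentwise Xs ps (replicate (suc n) skip)
                  → ∀ i → lookup ps i ≡ skip
  components-skip {ps} related i =
    IsSimulation.skipʳ (sims i) (subst (Xs i (lookup ps i)) (lookup-replicate i skip) (related i))

  par-transfer : ∀ {p q σ₁ σ₂ q' σ₂'} → ParSim p q → r σ₁ σ₂
               → Step ρ' (q , σ₂) (q' , σ₂')
               → Σ (Com α × α) λ { (p' , σ₁') →
                   Step ρ (p , σ₁) (p' , σ₁') × ParSim p' q' × r σ₁' σ₂' }
  par-transfer skip-skip _ ()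
  par-transfer (par-par {ps} {qs} related) rσ (par-step i stepᵢ)
    with IsSimulation.sim (sims i) (related i) rσ stepᵢ
  ... | (p' , σ₁') , stepᵢ' , rᵢ , rσ' =
    (par (ps [ i ]≔ p') , σ₁') , par-step i stepᵢ' , par-par (update-componentwise {R = Xs} {ps} {qs} i related rᵢ) , rσ'
  par-transfer {σ₁ = σ₁} (par-par {ps} related) rσ par-skip
    rewrite all-equal⇒replicate ps (components-skip {ps} related)
    = (skip , σ₁) , par-skip , skip-skip , rσ

  parSim-isSimulation : IsSimulation ρ ρ' r ParSim
  parSim-isSimulation = record
    { sim   = par-transfer
    ; skipˡ = λ { skip-skip → refl }
    ; skipʳ = λ { skip-skip → refl }
    }

mainTheorem12 : {α β : Set} (ρ : ℕ → Com α) (ρ' : ℕ → Com β) (r : α → β → Set)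
    {n : ℕ} (ps : Vec (Com α) (suc n)) (qs : Vec (Com β) (suc n))
    → ((i : Fin (suc n)) → Refines ρ ρ' r (lookup ps i) (lookup qs i))
    → Refines ρ ρ' r (par ps) (par qs)
mainTheorem12 ρ ρ' r ps qs refines =
  ParSim ρ ρ' r simulation isSimulation ,
  parSim-isSimulation ρ ρ' r simulation isSimulation ,
  par-par related
  where
  simulation : ∀ i → Com _ → Com _ → Set₁
  simulation i = let (X , _ , _) = refines i in X

  isSimulation : ∀ i → IsSimulation ρ ρ' r (simulation i)
  isSimulation i = let (_ , isSim , _) = refines i in isSim

  related : Componentwise simulation ps qs
  related i = let (_ , _ , pq) = refines i in pq
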